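{- Let $d=2$ and $n=2^\delta$ for an integer $\delta\ge 0$. Any growth schedule with $\log n$ slots that grows a path graph or a star graph on $n$ vertices uses $\Omega(n)$ excess edges.
   Context: Growth schedules with edge-activation distance $d$ (a fixed positive integer). A growth schedule of $k$ slots produces graphs $G_0,\dots,G_k$, where $G_0=(\{u_0\},\emptyset)$ is a single vertex. In slot $t$ the process sets $G_t=G_{t-1}$; for every $u\in V(G_{t-1})$ it may add at most one new vertex $u'$ with the edge $uu'$ and any subset of the edges $\{vu' : v\in V(G_{t-1}),\ \mathrm{dist}_{G_{t-1}}(u,v)\le d-1\}$; finally it deletes any set of edges of $G_t$ whose deletion does not disconnect $G_t$. Deleted edges are excess edges; their total number over all slots is the number of excess edges. The schedule grows $G$ if $G_k\cong G$. Logarithms are base 2. -}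

module Defs where

open import Data.Nat using (ℕ; zero; suc; _+_; _∸_; _<ᵇ_; _≡ᵇ_)
open import Data.Bool using (Bool; true; false; _∧_; _∨_; not; if_then_else_)
open import Data.Fin using (Fin; toℕ; splitAt; _≟_)
open import Data.List using (List; map; allFin)
open import Data.Nat.ListAction using (sum)
open import Data.Sum using (_⊎_; inj₁; inj₂)
open import Data.Product using (∃; ∃-syntax; Σ; _×_; _,_)
open import Relation.Nullary.Decidable using (⌊_⌋)
open import Relation.Binary.PropositionalEquality using (_≡_)
open import Function.Bundles using (_↔_; Inverse)

-- A (finite, simple) graph on vertex set Fin size, given by a Bool
-- adjacency function.  All graphs arising below are symmetric and
-- irreflexive (this is an invariant of the growth process).
record Graph : Set where
  constructor mkGraph
  field
    size : ℕ
    adj  : Fin size → Fin size → Bool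
open Graph public

G₀ : Graph
G₀ = mkGraph 1 (λ _ _ → false)

data WithinDist (G : Graph) : ℕ → Fin (size G) → Fin (size G) → Set where
  here : ∀ {k u} → WithinDist G k u u
  step : ∀ {k u w v} → adj G u w ≡ true → WithinDist G k w v → WithinDist G (suc k) u v

Connected : Graph → Set
Connected G = ∀ u v → ∃[ k ] WithinDist G k u v

countPairs : (n : ℕ) → (Fin n → Fin n → Bool) → ℕ
countPairs n f =
  sum (map (λ i → sum (map (λ j → if (toℕ i <ᵇ toℕ j) ∧ f i j then 1 else 0) (allFin n))) (allFin n))

-- The graph obtained from G by adding k new vertices (new vertex j is a child
-- of par j), with edge (par j) j' and the extra edges v j' where extra j v,
-- before deletions.  Old vertices are Fin n embedded on the left, new ones on
-- the right of Fin (n + k).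
grownAdj : (G : Graph) (k : ℕ) → (Fin k → Fin (size G)) → (Fin k → Fin (size G) → Bool) →
           Fin (size G + k) → Fin (size G + k) → Bool
grownAdj G k par extra x y with splitAt (size G) x | splitAt (size G) y
... | inj₁ a | inj₁ b = adj G a b
... | inj₁ a | inj₂ j = ⌊ par j ≟ a ⌋ ∨ extra j a
... | inj₂ j | inj₁ b = ⌊ par j ≟ b ⌋ ∨ extra j b
... | inj₂ _ | inj₂ _ = false

-- One slot of a growth schedule with edge-activation distance d, applied to G.
record Slot (d : ℕ) (G : Graph) : Set where
  field
    k      : ℕ
    par    : Fin k → Fin (size G)
    par-inj : ∀ i j → par i ≡ par j → i ≡ j  -- each vertex adds at most one child
    extra  : Fin k → Fin (size G) → Bool
    extra-ok : ∀ j v → extra j v ≡ true → WithinDist G (d ∸ 1) (par j) v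
    keep   : Fin (size G + k) → Fin (size G + k) → Bool
    keep-sym : ∀ x y → keep x y ≡ keep y x
  grown : Graph
  grown = mkGraph (size G + k) (grownAdj G k par extra)
  result : Graph
  result = mkGraph (size G + k) (λ x y → adj grown x y ∧ keep x y)
  deleted : ℕ
  deleted = countPairs (size G + k) (λ x y → adj grown x y ∧ not (keep x y))
  field
    result-connected : Connected result

data Schedule (d : ℕ) : ℕ → Graph → Set where
  []  : ∀ {G} → Schedule d 0 G
  _∷_ : ∀ {k G} (s : Slot d G) → Schedule d k (Slot.result s) → Schedule d (suc k) G

final : ∀ {d k G} → Schedule d k G → Graph
final {G = G} [] = G
final (s ∷ S) = final S

excessEdges : ∀ {d k G} → Schedule d k G → ℕ
excessEdges [] = 0
excessEdges (s ∷ S) = Slot.deleted s + excessEdges S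

record _≅_ (G H : Graph) : Set where
  field
    bij : Fin (size G) ↔ Fin (size H)
    pres : ∀ i j → adj H (Inverse.to bij i) (Inverse.to bij j) ≡ adj G i j

pathGraph : ℕ → Graph
pathGraph n = mkGraph n (λ i j → (suc (toℕ i) ≡ᵇ toℕ j) ∨ (suc (toℕ j) ≡ᵇ toℕ i))

starGraph : ℕ → Graph
starGraph n = mkGraph n (λ i j → ((toℕ i ≡ᵇ 0) ∧ not (toℕ j ≡ᵇ 0)) ∨ ((toℕ j ≡ᵇ 0) ∧ not (toℕ i ≡ᵇ 0)))

Grows : ∀ {d k} → Schedule d k G₀ → Graph → Set
Grows S H = final S ≅ H

{-# OPTIONS --safe #-}
module Submission where

-- A slot at most doubles the number of vertices, so a schedule with δ slots ending in
-- 2^δ vertices must, in its last slot, give each of the T = 2^(δ-1) old vertices u a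
-- new child u'.  Every old vertex, except the owners of the two ends of the target,
-- meets an edge deleted in that slot, so T ≤ 2·(deleted edges) + 2.  For a star, the
-- kept edge uu' must contain the centre.  For a path, an interior u' has two path
-- neighbours, which by d = 2 are u or old neighbours of u; keeping all edges at u would
-- create a triangle, or give u and u' the same two path neighbours, and a path has
-- neither.

open import Defs
open import Data.Nat using (ℕ; zero; suc; _+_; _*_; _^_; _≤_; _<_; z≤n; s≤s; z<s; _<ᵇ_; _≡ᵇ_)
import Data.Nat as ℕ
open import Data.Nat.Properties
open import Data.Nat.ListAction using (sum)
open import Data.Bool using (Bool; true; false; _∧_; _∨_; not; if_then_else_)
open import Data.Bool.Properties using (T-≡; T-∨; ∧-conicalˡ)
open import Data.Fin as Fin using (Fin; toℕ; _↑ˡ_; _↑ʳ_; splitAt; punchOut; fromℕ)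
import Data.Fin.Properties as Finₚ
open import Data.List using (List; []; _∷_; map; allFin; tabulate; length)
open import Data.List.Properties using (map-tabulate; length-map)
open import Data.List.Membership.Propositional using (_∈_)
open import Data.List.Membership.Propositional.Properties using (∈-map⁺)
open import Data.List.Relation.Unary.Any using (here; there)
open import Data.Product using (∃-syntax; _×_; _,_; proj₁; proj₂)
open import Data.Sum using (_⊎_; inj₁; inj₂; [_,_]′)
import Data.Sum as Sum
open import Function using (_∘_; id; Injective)
open import Function.Bundles using (Inverse; Injection; Equivalence)
open import Function.Properties.Inverse using (Inverse⇒Injection; ↔-sym)
open import Relation.Nullary using (¬_; Dec; yes; no; contradiction; _⊎-dec_)
open import Relation.Nullary.Decidable using (⌊_⌋; does)
open import Relation.Binary.PropositionalEquality
open import Relation.Binary.Definitions using (tri<; tri≈; tri>)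
open import Data.Nat.Tactic.RingSolver using (solve-∀)
open import Algebra.Properties.CommutativeMonoid.Sum +-0-commutativeMonoid
  using (∑-comm; ∑-distrib-+; sum-cong-≗; sum-replicate-zero)
  renaming (sum to ∑)

sum-tabulate : ∀ {n} (h : Fin n → ℕ) → sum (tabulate h) ≡ ∑ h
sum-tabulate {zero}  h = refl
sum-tabulate {suc n} h = cong (h Fin.zero +_) (sum-tabulate (h ∘ Fin.suc))

sum-map-allFin : ∀ {n} (h : Fin n → ℕ) → sum (map h (allFin n)) ≡ ∑ h
sum-map-allFin h = trans (cong sum (map-tabulate (λ i → i) h)) (sum-tabulate h)

∑-mono-≤ : ∀ {n} {f g : Fin n → ℕ} → (∀ i → f i ≤ g i) → ∑ f ≤ ∑ g
∑-mono-≤ {zero}  f≤g = z≤n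
∑-mono-≤ {suc n} f≤g = +-mono-≤ (f≤g Fin.zero) (∑-mono-≤ (f≤g ∘ Fin.suc))

∑-ones : ∀ n → ∑ {n} (λ _ → 1) ≡ n
∑-ones zero    = refl
∑-ones (suc n) = cong suc (∑-ones n)

term≤∑ : ∀ {n} (h : Fin n → ℕ) i → h i ≤ ∑ h
term≤∑ h Fin.zero    = m≤m+n _ _
term≤∑ h (Fin.suc i) = ≤-trans (term≤∑ (h ∘ Fin.suc) i) (m≤n+m _ _)

∑-↑ˡ≤∑ : ∀ m n (h : Fin (m + n) → ℕ) → ∑ (h ∘ (_↑ˡ n)) ≤ ∑ h
∑-↑ˡ≤∑ zero    n h = z≤n
∑-↑ˡ≤∑ (suc m) n h = +-monoʳ-≤ (h Fin.zero) (∑-↑ˡ≤∑ m n (h ∘ Fin.suc))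

indicator : ∀ {n} → Fin n → Fin n → ℕ
indicator x u = if does (x Finₚ.≟ u) then 1 else 0

∑-indicator : ∀ {n} (x : Fin n) → ∑ (indicator x) ≡ 1
∑-indicator {suc n} Fin.zero    = cong suc (sum-replicate-zero n)
∑-indicator {suc n} (Fin.suc x) = ∑-indicator x

≤∑+length : ∀ {n} (h : Fin n → ℕ) (xs : List (Fin n)) →
            (∀ u → 1 ≤ h u ⊎ u ∈ xs) → n ≤ ∑ h + length xs
≤∑+length {n} h [] positive = begin
  n                 ≡⟨ sym (∑-ones n) ⟩
  ∑ {n} (λ _ → 1)   ≤⟨ ∑-mono-≤ (λ u → [ id , (λ ()) ]′ (positive u)) ⟩
  ∑ h               ≡⟨ sym (+-identityʳ _) ⟩
  ∑ h + 0           ∎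
  where open ≤-Reasoning
≤∑+length {n} h (x ∷ xs) positive = begin
  n                                 ≤⟨ ≤∑+length h′ xs positive′ ⟩
  ∑ h′ + length xs                  ≡⟨ cong (_+ length xs) (∑-distrib-+ h (indicator x)) ⟩
  ∑ h + ∑ (indicator x) + length xs ≡⟨ cong (λ c → ∑ h + c + length xs) (∑-indicator x) ⟩
  ∑ h + 1 + length xs               ≡⟨ +-assoc (∑ h) 1 (length xs) ⟩
  ∑ h + length (x ∷ xs)             ∎
  where
  open ≤-Reasoning
  h′ : Fin n → ℕ
  h′ u = h u + indicator x u
  positive′ : ∀ u → 1 ≤ h′ u ⊎ u ∈ xs
  positive′ u with x Finₚ.≟ u | positive u
  ... | yes _   | _               = inj₁ (m≤n+m 1 (h u))
  ... | no _    | inj₁ 1≤h        = inj₁ (≤-trans 1≤h (m≤m+n _ _))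
  ... | no x≢u  | inj₂ (here u≡x) = contradiction (sym u≡x) x≢u
  ... | no _    | inj₂ (there u∈) = inj₂ u∈

pairIndicator : ∀ {n} → (Fin n → Fin n → Bool) → Fin n → Fin n → ℕ
pairIndicator f i j = if (toℕ i <ᵇ toℕ j) ∧ f i j then 1 else 0

incidences : ∀ {n} → (Fin n → Fin n → Bool) → Fin n → ℕ
incidences f x = ∑ (pairIndicator f x) + ∑ (λ i → pairIndicator f i x)

countPairs≡∑∑ : ∀ n (f : Fin n → Fin n → Bool) → countPairs n f ≡ ∑ (λ i → ∑ (pairIndicator f i))
countPairs≡∑∑ n f =
  trans (sum-map-allFin (λ i → sum (map (pairIndicator f i) (allFin n))))
        (sum-cong-≗ (λ i → sum-map-allFin (pairIndicator f i)))

handshake : ∀ n (f : Fin n → Fin n → Bool) → ∑ (incidences f) ≡ countPairs n f + countPairs n f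
handshake n f = begin
  ∑ (incidences f)                                       ≡⟨ ∑-distrib-+ (λ x → ∑ (pairIndicator f x)) _ ⟩
  ∑ (λ x → ∑ (pairIndicator f x)) + ∑ (λ x → ∑ (λ i → pairIndicator f i x))
    ≡⟨ cong₂ _+_ (sym (countPairs≡∑∑ n f))
                 (trans (sym (∑-comm (pairIndicator f))) (sym (countPairs≡∑∑ n f))) ⟩
  countPairs n f + countPairs n f                        ∎
  where open ≡-Reasoning

pairIndicator≡1 : ∀ {n} (f : Fin n → Fin n → Bool) {i j} →
                  toℕ i < toℕ j → f i j ≡ true → pairIndicator f i j ≡ 1
pairIndicator≡1 f {i} {j} i<j fij
  rewrite Equivalence.to T-≡ (<⇒<ᵇ i<j) | fij = refl

1≤incidences : ∀ {n} (f : Fin n → Fin n → Bool) {x y} → x ≢ y →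
               f x y ≡ true → f y x ≡ true → 1 ≤ incidences f x
1≤incidences f {x} {y} x≢y fxy fyx with <-cmp (toℕ x) (toℕ y)
... | tri< x<y _ _ = ≤-trans (≤-reflexive (sym (pairIndicator≡1 f x<y fxy)))
                       (≤-trans (term≤∑ (pairIndicator f x) y) (m≤m+n _ _))
... | tri≈ _ x≡y _ = contradiction (Finₚ.toℕ-injective x≡y) x≢y
... | tri> _ _ y<x = ≤-trans (≤-reflexive (sym (pairIndicator≡1 f y<x fyx)))
                       (≤-trans (term≤∑ (λ i → pairIndicator f i x) y) (m≤n+m _ _))

Consecutive : ℕ → ℕ → Set
Consecutive a b = suc a ≡ b ⊎ suc b ≡ a

pathAdj⇒consecutive : ∀ a b → ((suc a ≡ᵇ b) ∨ (suc b ≡ᵇ a)) ≡ true → Consecutive a b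
pathAdj⇒consecutive a b e with Equivalence.to T-∨ (Equivalence.from T-≡ e)
... | inj₁ t = inj₁ (≡ᵇ⇒≡ (suc a) b t)
... | inj₂ t = inj₂ (≡ᵇ⇒≡ (suc b) a t)

consecutive⇒pathAdj : ∀ a b → Consecutive a b → ((suc a ≡ᵇ b) ∨ (suc b ≡ᵇ a)) ≡ true
consecutive⇒pathAdj a b c =
  Equivalence.to T-≡ (Equivalence.from T-∨ (Sum.map (≡⇒≡ᵇ (suc a) b) (≡⇒≡ᵇ (suc b) a) c))

consecutive-triangle-free : ∀ {a b c} → Consecutive a b → Consecutive b c → ¬ Consecutive a c
consecutive-triangle-free (inj₁ refl) (inj₁ refl) (inj₁ ())
consecutive-triangle-free (inj₁ refl) (inj₁ refl) (inj₂ ())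
consecutive-triangle-free (inj₁ refl) (inj₂ refl) (inj₁ ())
consecutive-triangle-free (inj₁ refl) (inj₂ refl) (inj₂ ())
consecutive-triangle-free (inj₂ refl) (inj₁ refl) (inj₁ ())
consecutive-triangle-free (inj₂ refl) (inj₁ refl) (inj₂ ())
consecutive-triangle-free (inj₂ refl) (inj₂ refl) (inj₁ ())
consecutive-triangle-free (inj₂ refl) (inj₂ refl) (inj₂ ())

common-neighbours⇒≡ : ∀ {y z a₁ a₂} → a₁ ≢ a₂ →
                      Consecutive y a₁ → Consecutive y a₂ → Consecutive z a₁ → Consecutive z a₂ → y ≡ z
common-neighbours⇒≡ a₁≢a₂ (inj₁ refl) (inj₁ refl) _           _           = contradiction refl a₁≢a₂
common-neighbours⇒≡ a₁≢a₂ (inj₂ refl) (inj₂ refl) _           _           = contradiction refl a₁≢a₂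
common-neighbours⇒≡ _     (inj₁ refl) (inj₂ refl) (inj₁ refl) (inj₁ ())
common-neighbours⇒≡ _     (inj₁ refl) (inj₂ refl) (inj₁ refl) (inj₂ refl) = refl
common-neighbours⇒≡ _     (inj₁ refl) (inj₂ refl) (inj₂ refl) (inj₁ ())
common-neighbours⇒≡ _     (inj₁ refl) (inj₂ refl) (inj₂ refl) (inj₂ ())
common-neighbours⇒≡ _     (inj₂ refl) (inj₁ refl) (inj₁ ())   (inj₁ refl)
common-neighbours⇒≡ _     (inj₂ refl) (inj₁ refl) (inj₂ refl) (inj₁ refl) = refl
common-neighbours⇒≡ _     (inj₂ refl) (inj₁ refl) (inj₁ refl) (inj₂ ())
common-neighbours⇒≡ _     (inj₂ refl) (inj₁ refl) (inj₂ refl) (inj₂ ())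

PathEnd : ∀ {n} → Fin n → Set
PathEnd {n} c = toℕ c ≡ 0 ⊎ suc (toℕ c) ≡ n

pathEnd? : ∀ {n} (c : Fin n) → Dec (PathEnd c)
pathEnd? {n} c = (toℕ c ℕ.≟ 0) ⊎-dec (suc (toℕ c) ℕ.≟ n)

pathEnds : ∀ n → List (Fin n)
pathEnds zero    = []
pathEnds (suc n) = Fin.zero ∷ fromℕ n ∷ []

length-pathEnds≤2 : ∀ n → length (pathEnds n) ≤ 2
length-pathEnds≤2 zero    = z≤n
length-pathEnds≤2 (suc n) = ≤-refl

pathEnd⇒∈pathEnds : ∀ {n} {c : Fin n} → PathEnd c → c ∈ pathEnds n
pathEnd⇒∈pathEnds {suc n} {Fin.zero} _          = here refl
pathEnd⇒∈pathEnds {suc n} {Fin.suc c} (inj₂ e) =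
  there (here (Finₚ.toℕ-injective (trans (suc-injective e) (sym (Finₚ.toℕ-fromℕ n)))))

interior-neighbours : ∀ {n} (c : Fin n) → ¬ PathEnd c →
  ∃[ c₁ ] ∃[ c₂ ] toℕ c₁ ≢ toℕ c₂ × Consecutive (toℕ c) (toℕ c₁) × Consecutive (toℕ c) (toℕ c₂)
interior-neighbours {n} c notEnd with toℕ c in eq
... | zero  = contradiction (inj₁ refl) notEnd
... | suc q = Fin.fromℕ< q<n , Fin.fromℕ< q+2<n , distinct
            , inj₂ (cong suc (Finₚ.toℕ-fromℕ< q<n)) , inj₁ (sym (Finₚ.toℕ-fromℕ< q+2<n))
  where
  q+2≤n : suc (suc q) ≤ n
  q+2≤n = subst (λ a → suc a ≤ n) eq (Finₚ.toℕ<n c)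
  q<n : q < n
  q<n = ≤-trans (n≤1+n (suc q)) q+2≤n
  q+2<n : suc (suc q) < n
  q+2<n = ≤∧≢⇒< q+2≤n (notEnd ∘ inj₂)
  distinct : toℕ (Fin.fromℕ< q<n) ≢ toℕ (Fin.fromℕ< q+2<n)
  distinct e = <⇒≢ (m<n+m q {2} z<s)
    (trans (sym (Finₚ.toℕ-fromℕ< q<n)) (trans e (Finₚ.toℕ-fromℕ< q+2<n)))

starAdj⇒centre : ∀ a b → (((a ≡ᵇ 0) ∧ not (b ≡ᵇ 0)) ∨ ((b ≡ᵇ 0) ∧ not (a ≡ᵇ 0))) ≡ true →
                 a ≡ 0 ⊎ b ≡ 0
starAdj⇒centre zero    b       _ = inj₁ refl
starAdj⇒centre (suc a) zero    _ = inj₂ refl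
starAdj⇒centre (suc a) (suc b) ()

injective⇒surjective : ∀ {m n} {f : Fin m → Fin n} → Injective _≡_ _≡_ f → n ≤ m →
                       ∀ y → ∃[ x ] f x ≡ y
injective⇒surjective {m} {suc n} {f} f-inj n≤m y with Finₚ.any? (λ x → f x Finₚ.≟ y)
... | yes hit = hit
... | no miss = contradiction (Finₚ.injective⇒≤ punchOut-f-injective) (<⇒≱ n≤m)
  where
  f≢y : ∀ x → f x ≢ y
  f≢y x fx≡y = miss (x , fx≡y)
  punchOut-f-injective : Injective _≡_ _≡_ (λ x → punchOut (f≢y x ∘ sym))
  punchOut-f-injective e = f-inj (Finₚ.punchOut-injective (f≢y _ ∘ sym) (f≢y _ ∘ sym) e)

module _ {G H : Graph} (φ : G ≅ H) where
  open _≅_ φ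

  ≅-injective : Injective _≡_ _≡_ (Inverse.to bij)
  ≅-injective = Injection.injective (Inverse⇒Injection bij)

  ≅-size : size G ≡ size H
  ≅-size = Finₚ.cantor-schröder-bernstein ≅-injective
             (Injection.injective (Inverse⇒Injection (↔-sym bij)))

Symmetric : Graph → Set
Symmetric G = ∀ x y → adj G x y ≡ adj G y x

grownAdj-sym : ∀ G k par extra → Symmetric G →
               ∀ x y → grownAdj G k par extra x y ≡ grownAdj G k par extra y x
grownAdj-sym G k par extra sym-G x y with splitAt (size G) x | splitAt (size G) y
... | inj₁ a | inj₁ b = sym-G a b
... | inj₁ _ | inj₂ _ = refl
... | inj₂ _ | inj₁ _ = refl
... | inj₂ _ | inj₂ _ = refl

module _ {d : ℕ} {G : Graph} (s : Slot d G) where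
  open Slot s

  result-sym : Symmetric G → Symmetric result
  result-sym sym-G x y = cong₂ _∧_ (grownAdj-sym G k par extra sym-G x y) (keep-sym x y)

  children≤size : k ≤ size G
  children≤size = Finₚ.injective⇒≤ (par-inj _ _)

record LastSlot {d k G} (S : Schedule d (suc k) G) : Set where
  field
    before      : Graph
    slot        : Slot d before
    before-sym  : Symmetric before
    before-size : size before ≤ 2 ^ k * size G
    final≡      : final S ≡ Slot.result slot
    deleted≤    : Slot.deleted slot ≤ excessEdges S

lastSlot : ∀ {d k G} (S : Schedule d (suc k) G) → Symmetric G → LastSlot S
lastSlot {k = zero} {G} (s ∷ []) sym-G = record
  { before = G ; slot = s ; before-sym = sym-G
  ; before-size = ≤-reflexive (sym (+-identityʳ (size G)))
  ; final≡ = refl ; deleted≤ = m≤m+n _ _ }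
lastSlot {k = suc k} {G} (s ∷ S) sym-G = record
  { LastSlot rest
  ; before-size = begin
      size (LastSlot.before rest)          ≤⟨ LastSlot.before-size rest ⟩
      2 ^ k * (size G + Slot.k s)         ≤⟨ *-monoʳ-≤ (2 ^ k) (+-monoʳ-≤ (size G) (children≤size s)) ⟩
      2 ^ k * (size G + size G)           ≡⟨ cong (2 ^ k *_) (cong (size G +_) (sym (+-identityʳ (size G)))) ⟩
      2 ^ k * (2 * size G)                ≡⟨ sym (*-assoc (2 ^ k) 2 (size G)) ⟩
      2 ^ k * 2 * size G                  ≡⟨ cong (_* size G) (*-comm (2 ^ k) 2) ⟩
      2 ^ suc k * size G                  ∎
  ; deleted≤ = ≤-trans (LastSlot.deleted≤ rest) (m≤n+m _ _) }
  where
  open ≤-Reasoning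
  rest : LastSlot S
  rest = lastSlot S (result-sym s sym-G)

module LastSlotAnalysis {G : Graph} (s : Slot 2 G) (sym-G : Symmetric G)
                        (every-vertex-has-child : size G ≤ Slot.k s) where
  open Slot s

  p : ℕ
  p = size G

  old : Fin p → Fin (p + k)
  old u = u ↑ˡ k

  new : Fin k → Fin (p + k)
  new j = p ↑ʳ j

  grownEdge : Fin (p + k) → Fin (p + k) → Bool
  grownEdge = grownAdj G k par extra

  deletedEdge : Fin (p + k) → Fin (p + k) → Bool
  deletedEdge x y = grownEdge x y ∧ not (keep x y)

  deletedAt : Fin (p + k) → ℕ
  deletedAt = incidences deletedEdge

  grownEdge-old-old : ∀ u v → grownEdge (old u) (old v) ≡ adj G u v
  grownEdge-old-old u v rewrite Finₚ.splitAt-↑ˡ p u k | Finₚ.splitAt-↑ˡ p v k = refl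

  grownEdge-old-new : ∀ v j → grownEdge (old v) (new j) ≡ ⌊ par j Fin.≟ v ⌋ ∨ extra j v
  grownEdge-old-new v j rewrite Finₚ.splitAt-↑ˡ p v k | Finₚ.splitAt-↑ʳ p k j = refl

  grownEdge-new-old : ∀ j v → grownEdge (new j) (old v) ≡ ⌊ par j Fin.≟ v ⌋ ∨ extra j v
  grownEdge-new-old j v rewrite Finₚ.splitAt-↑ˡ p v k | Finₚ.splitAt-↑ʳ p k j = refl

  grownEdge-new-new : ∀ i j → grownEdge (new i) (new j) ≡ false
  grownEdge-new-new i j rewrite Finₚ.splitAt-↑ʳ p k i | Finₚ.splitAt-↑ʳ p k j = refl

  old≢new : ∀ u j → old u ≢ new j
  old≢new u j e with trans (sym (Finₚ.splitAt-↑ˡ p u k)) (trans (cong (splitAt p) e) (Finₚ.splitAt-↑ʳ p k j))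
  ... | ()

  parent-edge : ∀ j → grownEdge (old (par j)) (new j) ≡ true
  parent-edge j rewrite grownEdge-old-new (par j) j with par j Fin.≟ par j
  ... | yes _   = refl
  ... | no ne   = contradiction refl ne

  data OldOrNew : Fin (p + k) → Set where
    old-vertex : ∀ u → OldOrNew (old u)
    new-vertex : ∀ j → OldOrNew (new j)

  oldOrNew : ∀ x → OldOrNew x
  oldOrNew x with splitAt p x in split
  ... | inj₁ u = subst OldOrNew (Finₚ.splitAt⁻¹-↑ˡ split) (old-vertex u)
  ... | inj₂ j = subst OldOrNew (Finₚ.splitAt⁻¹-↑ʳ split) (new-vertex j)

  -- The only place where d = 2 is used.
  neighbour-of-new : ∀ j x → grownEdge (new j) x ≡ true →
    ∃[ v ] x ≡ old v × (v ≡ par j ⊎ par j ≢ v × adj G (par j) v ≡ true)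
  neighbour-of-new j x e with oldOrNew x
  ... | new-vertex i = contradiction (trans (sym (grownEdge-new-new j i)) e) (λ ())
  ... | old-vertex v with par j Fin.≟ v | trans (sym (grownEdge-new-old j v)) e
  ...   | yes refl | _ = v , refl , inj₁ refl
  ...   | no ne    | extra≡true with extra-ok j v extra≡true
  ...     | here        = contradiction refl ne
  ...     | step a here = v , refl , inj₂ (ne , a)

  deleted-or-kept : ∀ {x y} → x ≢ y → grownEdge x y ≡ true →
                    1 ≤ deletedAt x ⊎ adj result x y ≡ true
  deleted-or-kept {x} {y} x≢y e with keep x y in keep≡
  ... | true  = inj₂ (cong (_∧ true) e)
  ... | false = inj₁ (1≤incidences deletedEdge x≢y (isDeleted e keep≡) (isDeleted e′ (trans (keep-sym y x) keep≡)))
    where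
    isDeleted : ∀ {a b} → grownEdge a b ≡ true → keep a b ≡ false → deletedEdge a b ≡ true
    isDeleted g≡ k≡ = cong₂ (λ g κ → g ∧ not κ) g≡ k≡
    e′ : grownEdge y x ≡ true
    e′ = trans (grownAdj-sym G k par extra sym-G y x) e

  child : ∀ u → ∃[ j ] par j ≡ u
  child = injective⇒surjective (par-inj _ _) every-vertex-has-child

  owner : Fin (p + k) → Fin p
  owner x = [ id , par ]′ (splitAt p x)

  owner-old : ∀ u → owner (old u) ≡ u
  owner-old u rewrite Finₚ.splitAt-↑ˡ p u k = refl

  owner-new : ∀ j → owner (new j) ≡ par j
  owner-new j rewrite Finₚ.splitAt-↑ʳ p k j = refl

  size≤2*deleted+length : (xs : List (Fin p)) → (∀ u → 1 ≤ deletedAt (old u) ⊎ u ∈ xs) →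
                          p ≤ deleted + deleted + length xs
  size≤2*deleted+length xs covered = ≤-trans (≤∑+length (deletedAt ∘ old) xs covered)
    (+-monoˡ-≤ (length xs) (≤-trans (∑-↑ˡ≤∑ p k deletedAt) (≤-reflexive (handshake (p + k) deletedEdge))))

  module _ {H : Graph} (φ : result ≅ H) where
    open _≅_ φ
    open Inverse bij using (to; from; strictlyInverseʳ)

    OwnsPathEnd : Fin p → Set
    OwnsPathEnd u = ∃[ x ] owner x ≡ u × PathEnd (to x)

    size≤2*deleted+2 : (∀ u → 1 ≤ deletedAt (old u) ⊎ OwnsPathEnd u) → p ≤ deleted + deleted + 2
    size≤2*deleted+2 covered = begin
      p                                               ≤⟨ size≤2*deleted+length exceptions (Sum.map₂ listed ∘ covered) ⟩
      deleted + deleted + length exceptions           ≡⟨ cong (deleted + deleted +_) (length-map _ (pathEnds (size H))) ⟩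
      deleted + deleted + length (pathEnds (size H))  ≤⟨ +-monoʳ-≤ (deleted + deleted) (length-pathEnds≤2 (size H)) ⟩
      deleted + deleted + 2                           ∎
      where
      open ≤-Reasoning
      exceptions : List (Fin p)
      exceptions = map (owner ∘ from) (pathEnds (size H))
      listed : ∀ {u} → OwnsPathEnd u → u ∈ exceptions
      listed (x , refl , end) =
        subst (λ y → owner y ∈ exceptions) (strictlyInverseʳ x) (∈-map⁺ (owner ∘ from) (pathEnd⇒∈pathEnds end))

  -- The centre of a star sits at position 0, so it is a PathEnd.
  star-bound : ∀ {n} → result ≅ starGraph n → p ≤ deleted + deleted + 2
  star-bound φ = size≤2*deleted+2 φ covered
    where
    open _≅_ φ
    covered : ∀ u → 1 ≤ deletedAt (old u) ⊎ OwnsPathEnd φ u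
    covered u with child u
    ... | j , refl with deleted-or-kept (old≢new (par j) j) (parent-edge j)
    ...   | inj₁ deletion = inj₁ deletion
    ...   | inj₂ kept with starAdj⇒centre _ _ (trans (pres (old (par j)) (new j)) kept)
    ...     | inj₁ centre = inj₂ (old (par j) , owner-old (par j) , inj₁ centre)
    ...     | inj₂ centre = inj₂ (new j , owner-new j , inj₁ centre)

  module PathTarget {n : ℕ} (φ : result ≅ pathGraph n) where
    open _≅_ φ
    open Inverse bij using (to; from; strictlyInverseˡ)

    pos : Fin (p + k) → ℕ
    pos x = toℕ (to x)

    pos-from : ∀ c → pos (from c) ≡ toℕ c
    pos-from c = cong toℕ (strictlyInverseˡ c)

    kept⇒consecutive : ∀ {x y} → adj result x y ≡ true → Consecutive (pos x) (pos y)
    kept⇒consecutive {x} {y} e = pathAdj⇒consecutive _ _ (trans (pres x y) e)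

    consecutive⇒kept : ∀ {x y} → Consecutive (pos x) (pos y) → adj result x y ≡ true
    consecutive⇒kept {x} {y} c = trans (sym (pres x y)) (consecutive⇒pathAdj _ _ c)

    old-edge : ∀ {u v} → u ≢ v → adj G u v ≡ true → 1 ≤ deletedAt (old u) ⊎ adj result (old u) (old v) ≡ true
    old-edge u≢v uv = deleted-or-kept (u≢v ∘ Finₚ.↑ˡ-injective k _ _) (trans (grownEdge-old-old _ _) uv)

    triangle⇒deletion : ∀ {u v} c → u ≢ v → adj G u v ≡ true →
      Consecutive (pos c) (pos (old u)) → Consecutive (pos c) (pos (old v)) → 1 ≤ deletedAt (old u)
    triangle⇒deletion c u≢v uv cu cv with old-edge u≢v uv
    ... | inj₁ deletion = deletion
    ... | inj₂ kept     = contradiction cv (consecutive-triangle-free cu (kept⇒consecutive kept))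

    square⇒deletion : ∀ {u v₁ v₂} c → pos c ≢ pos (old u) → pos (old v₁) ≢ pos (old v₂) →
      u ≢ v₁ → adj G u v₁ ≡ true → u ≢ v₂ → adj G u v₂ ≡ true →
      Consecutive (pos c) (pos (old v₁)) → Consecutive (pos c) (pos (old v₂)) → 1 ≤ deletedAt (old u)
    square⇒deletion c c≢u v₁≢v₂ u≢v₁ uv₁ u≢v₂ uv₂ cv₁ cv₂ with old-edge u≢v₁ uv₁ | old-edge u≢v₂ uv₂
    ... | inj₁ deletion | _             = deletion
    ... | inj₂ _        | inj₁ deletion = deletion
    ... | inj₂ kept₁    | inj₂ kept₂    = contradiction
      (common-neighbours⇒≡ v₁≢v₂ cv₁ cv₂ (kept⇒consecutive kept₁) (kept⇒consecutive kept₂)) c≢u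

    two-kept-neighbours⇒deletion : ∀ j {x₁ x₂} → pos x₁ ≢ pos x₂ →
      adj result (new j) x₁ ≡ true → adj result (new j) x₂ ≡ true → 1 ≤ deletedAt (old (par j))
    two-kept-neighbours⇒deletion j {x₁} {x₂} x₁≢x₂ kept₁ kept₂
      with neighbour-of-new j x₁ (∧-conicalˡ _ _ kept₁) | neighbour-of-new j x₂ (∧-conicalˡ _ _ kept₂)
    ... | _ , refl , inj₁ refl          | _ , refl , inj₁ refl          = contradiction refl x₁≢x₂
    ... | _ , refl , inj₁ refl          | _ , refl , inj₂ (ne₂ , adj₂) =
      triangle⇒deletion (new j) ne₂ adj₂ (kept⇒consecutive kept₁) (kept⇒consecutive kept₂)
    ... | _ , refl , inj₂ (ne₁ , adj₁) | _ , refl , inj₁ refl          =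
      triangle⇒deletion (new j) ne₁ adj₁ (kept⇒consecutive kept₂) (kept⇒consecutive kept₁)
    ... | _ , refl , inj₂ (ne₁ , adj₁) | _ , refl , inj₂ (ne₂ , adj₂) =
      square⇒deletion (new j) new≢old x₁≢x₂ ne₁ adj₁ ne₂ adj₂ (kept⇒consecutive kept₁) (kept⇒consecutive kept₂)
      where
      new≢old : pos (new j) ≢ pos (old (par j))
      new≢old e = old≢new (par j) j (sym (≅-injective φ (Finₚ.toℕ-injective e)))

    path-bound : p ≤ deleted + deleted + 2
    path-bound = size≤2*deleted+2 φ covered
      where
      covered : ∀ u → 1 ≤ deletedAt (old u) ⊎ OwnsPathEnd φ u
      covered u with child u
      ... | j , refl with pathEnd? (to (new j))
      ...   | yes end     = inj₂ (new j , owner-new j , end)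
      ...   | no interior with interior-neighbours (to (new j)) interior
      ...     | c₁ , c₂ , c₁≢c₂ , next₁ , next₂ = inj₁ (two-kept-neighbours⇒deletion j
                  (λ e → c₁≢c₂ (trans (sym (pos-from c₁)) (trans e (pos-from c₂))))
                  (consecutive⇒kept (subst (Consecutive (pos (new j))) (sym (pos-from c₁)) next₁))
                  (consecutive⇒kept (subst (Consecutive (pos (new j))) (sym (pos-from c₂)) next₂)))

  deletion-bound : ∀ {n} → result ≅ pathGraph n ⊎ result ≅ starGraph n → p ≤ deleted + deleted + 2
  deletion-bound (inj₁ φ) = PathTarget.path-bound φ
  deletion-bound (inj₂ φ) = star-bound φ

forced-doubling : ∀ {p k T} → k ≤ p → p ≤ T → p + k ≡ 2 * T → p ≡ T × k ≡ T
forced-doubling {p} {k} {T} k≤p p≤T p+k≡2T = p≡T , +-cancelˡ-≡ p k T (begin-equality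
    p + k        ≡⟨ p+k≡2T ⟩
    T + (T + 0)  ≡⟨ cong (_+ (T + 0)) (sym p≡T) ⟩
    p + (T + 0)  ≡⟨ cong (p +_) (+-identityʳ T) ⟩
    p + T        ∎)
  where
  open ≤-Reasoning
  T≤p : T ≤ p
  T≤p = *-cancelˡ-≤ 2 (begin
    2 * T        ≡⟨ sym p+k≡2T ⟩
    p + k        ≤⟨ +-monoʳ-≤ p k≤p ⟩
    p + p        ≡⟨ cong (p +_) (sym (+-identityʳ p)) ⟩
    2 * p        ∎)
  p≡T : p ≡ T
  p≡T = ≤-antisym p≤T T≤p

T≤2D+2⇒2T≤8D : ∀ {T D} → 4 ≤ T → T ≤ D + D + 2 → 2 * T ≤ 8 * D
T≤2D+2⇒2T≤8D {D = zero}  4≤T T≤2 = contradiction (≤-trans 4≤T T≤2) λ { (s≤s (s≤s ())) }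
T≤2D+2⇒2T≤8D {T} {suc D} _ T≤ = begin
  2 * T                                   ≤⟨ *-monoʳ-≤ 2 T≤ ⟩
  2 * (suc D + suc D + 2)                 ≤⟨ m≤m+n _ (4 * D) ⟩
  2 * (suc D + suc D + 2) + 4 * D         ≡⟨ regroup D ⟩
  8 * suc D                               ∎
  where
  open ≤-Reasoning
  regroup : ∀ D → 2 * (suc D + suc D + 2) + 4 * D ≡ 8 * suc D
  regroup = solve-∀

mainTheorem14 : ∃[ c ] ∃[ δ₀ ] ∀ (δ : ℕ) → δ₀ ≤ δ → (S : Schedule 2 δ G₀) →
                  (Grows S (pathGraph (2 ^ δ)) ⊎ Grows S (starGraph (2 ^ δ))) →
                  2 ^ δ ≤ c * excessEdges S
mainTheorem14 = 8 , 3 , bound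
  where
  bound : ∀ δ → 3 ≤ δ → (S : Schedule 2 δ G₀) →
          (Grows S (pathGraph (2 ^ δ)) ⊎ Grows S (starGraph (2 ^ δ))) → 2 ^ δ ≤ 8 * excessEdges S
  bound (suc δ) (s≤s 2≤δ) S grows = begin
    2 * 2 ^ δ              ≤⟨ T≤2D+2⇒2T≤8D {D = D} (^-monoʳ-≤ 2 2≤δ) (subst (_≤ D + D + 2) before≡ deletions) ⟩
    8 * D                  ≤⟨ *-monoʳ-≤ 8 deleted≤ ⟩
    8 * excessEdges S      ∎
    where
    open ≤-Reasoning
    open LastSlot (lastSlot S (λ _ _ → refl))
    target : Slot.result slot ≅ pathGraph (2 ^ suc δ) ⊎ Slot.result slot ≅ starGraph (2 ^ suc δ)
    target = Sum.map (subst (_≅ _) final≡) (subst (_≅ _) final≡) grows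
    sizes : size before ≡ 2 ^ δ × Slot.k slot ≡ 2 ^ δ
    sizes = forced-doubling (children≤size slot)
      (≤-trans before-size (≤-reflexive (*-identityʳ (2 ^ δ)))) ([ ≅-size , ≅-size ]′ target)
    before≡ : size before ≡ 2 ^ δ
    before≡ = proj₁ sizes
    D : ℕ
    D = Slot.deleted slot
    deletions : size before ≤ D + D + 2
    deletions = LastSlotAnalysis.deletion-bound slot before-sym
      (≤-reflexive (trans before≡ (sym (proj₂ sizes)))) target
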